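{- Every partition tautology is a subset tautology.
   Context: Formulas are built from atomic variables and constants $0,1$ with binary connectives $\vee,\wedge,\Rightarrow,\mid$. Subset semantics: for a nonempty set $U$, assign subsets of $U$ to the variables, $0=\emptyset$, $1=U$, $\vee=\cup$, $\wedge=\cap$, $A\Rightarrow B=(U\setminus A)\cup B$, $A\mid B=U\setminus(A\cap B)$; a subset tautology is a formula evaluating to $U$ for every nonempty $U$ and every assignment. Partition semantics: for a set $U$ with $|U|\ge 2$, assign partitions on $U$ (sets of nonempty pairwise disjoint blocks with union $U$) to the variables; with $\operatorname{dit}(\pi)$ the set of ordered pairs in different blocks, $\operatorname{indit}(\pi)$ its complement, $\overline S$ the smallest equivalence relation containing $S\subseteq U\times U$ and $\operatorname{int}(S)=U\times U\setminus\overline{U\times U\setminus S}$: $0=\{U\}$, $1$ = discrete partition, $\operatorname{dit}(\sigma\vee\tau)=\operatorname{dit}\sigma\cup\operatorname{dit}\tau$, $\operatorname{dit}(\sigma\wedge\tau)=\operatorname{int}(\operatorname{dit}\sigma\cap\operatorname{dit}\tau)$, $\operatorname{dit}(\sigma\Rightarrow\tau)=\operatorname{int}((U\times U\setminus\operatorname{dit}\sigma)\cup\operatorname{dit}\tau)$, $\operatorname{dit}(\sigma\mid\tau)=\operatorname{int}(\operatorname{indit}\sigma\cup\operatorname{indit}\tau)$. A partition tautology is a formula evaluating to the partition $1$ for every $U$ with $|U|\ge2$ and every assignment. -}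

module Defs where

open import Data.Nat using (ℕ)
open import Data.Bool using (Bool; true; false; not) renaming (_∨_ to _∨ᵇ_; _∧_ to _∧ᵇ_)
open import Data.Empty using (⊥)
open import Data.Sum using (_⊎_)
open import Data.Product using (_×_; Σ; _,_)
open import Relation.Nullary using (¬_)
open import Relation.Binary.PropositionalEquality using (_≡_; _≢_)
open import Relation.Binary.Construct.Closure.Equivalence using (EqClosure)

data Formula : Set where
  var   : ℕ → Formula
  𝟘 𝟙   : Formula
  _∨ᶠ_  : Formula → Formula → Formula
  _∧ᶠ_  : Formula → Formula → Formula
  _⇒ᶠ_  : Formula → Formula → Formula
  _∣ᶠ_  : Formula → Formula → Formula

Subset : Set → Set
Subset U = U → Bool

evalS : {U : Set} → (ℕ → Subset U) → Formula → Subset U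
evalS A (var i)   u = A i u
evalS A 𝟘         u = false
evalS A 𝟙         u = true
evalS A (φ ∨ᶠ ψ)  u = evalS A φ u ∨ᵇ evalS A ψ u
evalS A (φ ∧ᶠ ψ)  u = evalS A φ u ∧ᵇ evalS A ψ u
evalS A (φ ⇒ᶠ ψ)  u = not (evalS A φ u) ∨ᵇ evalS A ψ u
evalS A (φ ∣ᶠ ψ)  u = not (evalS A φ u ∧ᵇ evalS A ψ u)

-- φ evaluates to U for every nonempty U and every assignment
-- (nonemptiness is immaterial: the condition is pointwise in u : U).
SubsetTautology : Formula → Set₁
SubsetTautology φ = (U : Set) → U → (A : ℕ → Subset U) → (u : U) → evalS A φ u ≡ true

-- Partition semantics.
-- A partition on U is given by its indistinction relation, an equivalence
-- relation on U (blocks = equivalence classes).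

record Partition (U : Set) : Set₁ where
  field
    _~_     : U → U → Set
    ~-refl  : ∀ {x} → x ~ x
    ~-sym   : ∀ {x y} → x ~ y → y ~ x
    ~-trans : ∀ {x y z} → x ~ y → y ~ z → x ~ z

PairSet : Set → Set₁
PairSet U = U → U → Set

dit : {U : Set} → Partition U → PairSet U
dit π x y = ¬ (Partition._~_ π x y)

compl : {U : Set} → PairSet U → PairSet U
compl S x y = ¬ S x y

closure : {U : Set} → PairSet U → PairSet U
closure S = EqClosure S

int : {U : Set} → PairSet U → PairSet U
int S = compl (closure (compl S))

ditP : {U : Set} → (ℕ → Partition U) → Formula → PairSet U
ditP P (var i)  = dit (P i)
ditP P 𝟘        = λ _ _ → ⊥                  -- 0 = {U}: no distinctions
ditP P 𝟙        = λ x y → x ≢ y              -- 1 = discrete partition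
ditP P (φ ∨ᶠ ψ) = λ x y → ditP P φ x y ⊎ ditP P ψ x y
ditP P (φ ∧ᶠ ψ) = int (λ x y → ditP P φ x y × ditP P ψ x y)
ditP P (φ ⇒ᶠ ψ) = int (λ x y → compl (ditP P φ) x y ⊎ ditP P ψ x y)
ditP P (φ ∣ᶠ ψ) = int (λ x y → compl (ditP P φ) x y ⊎ compl (ditP P ψ) x y)

-- φ evaluates to the discrete partition 1 for every U with |U| ≥ 2 and every
-- assignment, i.e. its dit-set is exactly the set of pairs of distinct elements.
PartitionTautology : Formula → Set₁
PartitionTautology φ =
  (U : Set) → (a b : U) → a ≢ b → (P : ℕ → Partition U) →
  (x y : U) → (ditP P φ x y → x ≢ y) × (x ≢ y → ditP P φ x y)

-- On any set, the indiscrete partition 0 and the discrete partition 1 form a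
-- sub-algebra of the partition algebra, and b ↦ (b ? 1 : 0) is a homomorphism
-- from the Boolean algebra of truth values.  So evaluating a formula pointwise
-- at u, with partition 1 assigned to the variables whose subset contains u and
-- 0 to the others, yields 1 exactly when u lies in the subset value.  A
-- partition tautology evaluates to 1 on a two-element set, so its subset value
-- contains u.

module Submission where

open import Data.Bool using (Bool; true; false; not) renaming (_∨_ to _∨ᵇ_; _∧_ to _∧ᵇ_)
open import Data.Empty using (⊥-elim)
open import Data.Nat using (ℕ)
open import Data.Product using (_×_; _,_; proj₂)
open import Data.Sum using (_⊎_; inj₁; inj₂; [_,_])
open import Data.Unit using (⊤; tt)
open import Relation.Nullary using (¬_)
open import Relation.Binary.PropositionalEquality using (_≡_; _≢_; refl; sym; trans)
open import Relation.Binary.Construct.Closure.Symmetric using (fwd; bwd)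
open import Relation.Binary.Construct.Closure.ReflexiveTransitive using (ε; _◅_)
open import Defs

module _ {U : Set} where

  DistinguishesAll DistinguishesNone : PairSet U → Set
  DistinguishesAll S  = ∀ {x y} → x ≢ y → S x y
  DistinguishesNone S = ∀ {x y} → x ≢ y → ¬ S x y

  data IsDitOf : Bool → PairSet U → Set₁ where
    discrete   : ∀ {S} → DistinguishesAll S  → IsDitOf true S
    indiscrete : ∀ {S} → DistinguishesNone S → IsDitOf false S

  partition₂ : Bool → Partition U
  partition₂ true  = record { _~_ = _≡_ ; ~-refl = refl ; ~-sym = sym ; ~-trans = trans }
  partition₂ false = record { _~_ = λ _ _ → ⊤ ; ~-refl = tt ; ~-sym = λ _ → tt ; ~-trans = λ _ _ → tt }

  dit-partition₂ : ∀ b → IsDitOf b (dit (partition₂ b))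
  dit-partition₂ true  = discrete λ x≢y x≡y → x≢y x≡y
  dit-partition₂ false = indiscrete λ _ ¬⊤ → ¬⊤ tt

  -- Equality is only ¬¬-stable here, so the chain argument runs in the ¬¬ monad.
  closure-¬¬≡ : ∀ {R : PairSet U} → (∀ {x y} → R x y → ¬ ¬ x ≡ y) →
                ∀ {x y} → closure R x y → ¬ ¬ x ≡ y
  closure-¬¬≡ r ε x≢x = x≢x refl
  closure-¬¬≡ r (fwd xRz ◅ z~y) x≢y =
    r xRz λ x≡z → closure-¬¬≡ r z~y λ z≡y → x≢y (trans x≡z z≡y)
  closure-¬¬≡ r (bwd zRx ◅ z~y) x≢y =
    r zRx λ z≡x → closure-¬¬≡ r z~y λ z≡y → x≢y (trans (sym z≡x) z≡y)

  int-isDitOf : ∀ {b S} → IsDitOf b S → IsDitOf b (int S)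
  int-isDitOf (discrete all)   = discrete λ x≢y c → closure-¬¬≡ (λ ¬S x≢y′ → ¬S (all x≢y′)) c x≢y
  int-isDitOf (indiscrete none) = indiscrete λ x≢y i → i (fwd (none x≢y) ◅ ε)

  compl-isDitOf : ∀ {b S} → IsDitOf b S → IsDitOf (not b) (compl S)
  compl-isDitOf (discrete all)   = indiscrete λ x≢y ¬S → ¬S (all x≢y)
  compl-isDitOf (indiscrete none) = discrete none

  ⊎-isDitOf : ∀ {a b S T} → IsDitOf a S → IsDitOf b T →
              IsDitOf (a ∨ᵇ b) (λ x y → S x y ⊎ T x y)
  ⊎-isDitOf (discrete s)   _              = discrete λ x≢y → inj₁ (s x≢y)
  ⊎-isDitOf (indiscrete _) (discrete t)   = discrete λ x≢y → inj₂ (t x≢y)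
  ⊎-isDitOf (indiscrete s) (indiscrete t) = indiscrete λ x≢y → [ s x≢y , t x≢y ]

  ×-isDitOf : ∀ {a b S T} → IsDitOf a S → IsDitOf b T →
              IsDitOf (a ∧ᵇ b) (λ x y → S x y × T x y)
  ×-isDitOf (discrete s)   (discrete t)   = discrete λ x≢y → s x≢y , t x≢y
  ×-isDitOf (discrete _)   (indiscrete t) = indiscrete λ x≢y (_ , Ty) → t x≢y Ty
  ×-isDitOf (indiscrete s) _              = indiscrete λ x≢y (Sx , _) → s x≢y Sx

  nand-isDitOf : ∀ {a b S T} → IsDitOf a S → IsDitOf b T →
                 IsDitOf (not (a ∧ᵇ b)) (λ x y → compl S x y ⊎ compl T x y)
  nand-isDitOf s@(discrete _)   t = ⊎-isDitOf (compl-isDitOf s) (compl-isDitOf t)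
  nand-isDitOf s@(indiscrete _) t = ⊎-isDitOf (compl-isDitOf s) (compl-isDitOf t)

  isDitOf-distinct⇒true : ∀ {b S x y} → IsDitOf b S → x ≢ y → S x y → b ≡ true
  isDitOf-distinct⇒true (discrete _)      _   _ = refl
  isDitOf-distinct⇒true (indiscrete none) x≢y d = ⊥-elim (none x≢y d)

module _ {U V : Set} (A : ℕ → Subset U) (u : U) where

  ditP-partition₂ : ∀ φ → IsDitOf {V} (evalS A φ u) (ditP (λ i → partition₂ (A i u)) φ)
  ditP-partition₂ (var i)  = dit-partition₂ (A i u)
  ditP-partition₂ 𝟘        = indiscrete λ _ ()
  ditP-partition₂ 𝟙        = discrete λ x≢y → x≢y
  ditP-partition₂ (φ ∨ᶠ ψ) = ⊎-isDitOf (ditP-partition₂ φ) (ditP-partition₂ ψ)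
  ditP-partition₂ (φ ∧ᶠ ψ) = int-isDitOf (×-isDitOf (ditP-partition₂ φ) (ditP-partition₂ ψ))
  ditP-partition₂ (φ ⇒ᶠ ψ) = int-isDitOf (⊎-isDitOf (compl-isDitOf (ditP-partition₂ φ)) (ditP-partition₂ ψ))
  ditP-partition₂ (φ ∣ᶠ ψ) = int-isDitOf (nand-isDitOf (ditP-partition₂ φ) (ditP-partition₂ ψ))

mainTheorem9 : (φ : Formula) → PartitionTautology φ → SubsetTautology φ
mainTheorem9 φ taut U _ A u =
  isDitOf-distinct⇒true (ditP-partition₂ A u φ) true≢false truePartedFromFalse
  where
  true≢false : true ≢ false
  true≢false ()

  truePartedFromFalse : ditP (λ i → partition₂ (A i u)) φ true false
  truePartedFromFalse = proj₂ (taut Bool true false true≢false _ true false) true≢false
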